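{- Let $p$ be a fixed odd prime, $\alpha\in\mathbb N$ and $A,B\ge1$. Then $$D_0(A,B;p^\alpha)\ll\frac{\sqrt{AB}}{p^\alpha}+\min\Big(\sqrt{\tfrac AB},\sqrt{\tfrac BA}\Big).$$ In particular $D_0(A,B;p^\alpha)=O(\sqrt{AB}/p^\alpha+1)$.
   Context: $$D_0(A,B;p^\alpha)=\frac{1}{\sqrt{AB}}\#\{(a,b)\in\mathbb Z^2:\ A\le a<2A,\ B\le b<2B,\ p\nmid ab,\ a\ne b,\ a^{p-1}\equiv b^{p-1}\ (\mathrm{mod}\ p^\alpha)\}.$$
   Formalization: The parameters A and B, with $A,B\ge1$, are taken over the rationals. -}

module Defs where

open import Data.Nat as ℕ using (ℕ; _^_; _∸_; ∣_-_∣)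
open import Data.Nat.Divisibility using (_∣_; _∣?_)
open import Data.Integer as ℤ using (ℤ; +_)
open import Data.Rational using (ℚ; _/_; _≤_; _<_; _*_; ceiling)
open import Data.Rational.Properties using (_≤?_; _<?_)
open import Data.List using (List; length; filter; upTo; cartesianProduct)
open import Data.Product using (_×_; _,_)
open import Relation.Nullary using (¬_; Dec)
open import Relation.Nullary.Decidable using (_×-dec_; ¬?)
open import Relation.Binary.PropositionalEquality using (_≢_)

⟦_⟧ : ℕ → ℚ
⟦ a ⟧ = + a / 1

InDyadic : ℚ → ℕ → Set
InDyadic A a = (A ≤ ⟦ a ⟧) × (⟦ a ⟧ < (+ 2 / 1) * A)

inDyadic? : (A : ℚ) (a : ℕ) → Dec (InDyadic A a)
inDyadic? A a = (A ≤? ⟦ a ⟧) ×-dec (⟦ a ⟧ <? (+ 2 / 1) * A)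

_≡_[mod_] : ℕ → ℕ → ℕ → Set
x ≡ y [mod m ] = m ∣ ∣ x - y ∣

-- the pair (a,b) is counted by D₀(A,B;p^α)
-- (a,b are automatically positive integers since A,B ≥ 1)
Counted : ℕ → ℕ → ℚ → ℚ → ℕ × ℕ → Set
Counted p α A B (a , b) =
  InDyadic A a × InDyadic B b × ¬ (p ∣ a ℕ.* b) × a ≢ b ×
  ((a ^ (p ∸ 1)) ≡ (b ^ (p ∸ 1)) [mod (p ^ α) ])

counted? : ∀ p α A B (x : ℕ × ℕ) → Dec (Counted p α A B x)
counted? p α A B (a , b) =
  inDyadic? A a ×-dec inDyadic? B b ×-dec ¬? (p ∣? a ℕ.* b) ×-dec
  ¬? (a ℕ.≟ b) ×-dec (p ^ α ∣? ∣ a ^ (p ∸ 1) - b ^ (p ∸ 1) ∣)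

-- every integer a with a < 2A (and a ≥ 0) lies in upTo (dyadicBound A)
dyadicBound : ℚ → ℕ
dyadicBound A = ℕ.suc ℤ.∣ ceiling ((+ 2 / 1) * A) ∣

-- the raw count  #{(a,b) : A ≤ a < 2A, B ≤ b < 2B, p ∤ ab, a ≠ b,
--                          a^(p-1) ≡ b^(p-1) mod p^α}
-- so that D₀(A,B;p^α) = D0count p α A B / √(AB).
D0count : ℕ → ℕ → ℚ → ℚ → ℕ
D0count p α A B =
  length (filter (counted? p α A B)
    (cartesianProduct (upTo (dyadicBound A)) (upTo (dyadicBound B))))

module Submission where

-- Write n = p − 1 and q = p ^ α. For fixed a, the partners b ∈ [B, 2B) of a (p ∤ b, bⁿ ≡ aⁿ mod q) lie in at
-- most p residue classes mod p, and two partners in the same class are congruent mod q: bⁿ − b'ⁿ factors as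
-- (b − b') * geometric b b' n, and for b ≡ b' ≢ 0 (mod p) the second factor is ≡ n bⁿ⁻¹ ≢ 0 (mod p). Hence a
-- class holds at most B/q + 1 partners, and summing over the at most 2A values of a gives
-- D * q ≤ 2A * p * (B + q). Counting by columns instead gives the bound with A and B exchanged.

module FiniteSums where
  open import Data.Nat
  open import Data.Nat.Properties
  open import Data.Nat.Solver using (module +-*-Solver)
  open import Data.List using (List; []; _∷_; _++_; [_]; upTo; length; map; filter; cartesianProduct)
  open import Data.List.Properties using (upTo-∷ʳ; filter-++; length-++)
  open import Data.List.Membership.Propositional using (_∈_)
  open import Data.List.Relation.Unary.Any using (here; there)
  open import Data.Product using (_×_; _,_)
  open import Data.Empty using (⊥-elim)
  open import Relation.Nullary using (¬_; Dec; yes; no)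
  open import Relation.Unary using (Pred; Decidable)
  open import Relation.Binary.PropositionalEquality hiding ([_])
  open +-*-Solver

  𝟙 : {P : Set} → Dec P → ℕ
  𝟙 (yes _) = 1
  𝟙 (no _) = 0

  𝟙-mono : {P Q : Set} → (P → Q) → (P? : Dec P) (Q? : Dec Q) → 𝟙 P? ≤ 𝟙 Q?
  𝟙-mono P⇒Q (yes p) (yes q) = ≤-refl
  𝟙-mono P⇒Q (yes p) (no ¬q) = ⊥-elim (¬q (P⇒Q p))
  𝟙-mono P⇒Q (no _) Q? = z≤n

  𝟙-no : {P : Set} → ¬ P → (P? : Dec P) → 𝟙 P? ≡ 0
  𝟙-no ¬p (yes p) = ⊥-elim (¬p p)
  𝟙-no ¬p (no _) = refl

  ∑ : {A : Set} → List A → (A → ℕ) → ℕ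
  ∑ [] f = 0
  ∑ (x ∷ xs) f = f x + ∑ xs f

  syntax ∑ xs (λ x → e) = ∑[ x ∈ xs ] e

  module _ {A : Set} where

    ∑-++ : ∀ (xs ys : List A) f → ∑ (xs ++ ys) f ≡ ∑ xs f + ∑ ys f
    ∑-++ [] ys f = refl
    ∑-++ (x ∷ xs) ys f = trans (cong (f x +_) (∑-++ xs ys f)) (sym (+-assoc (f x) _ _))

    ∑-mono-≤ : ∀ (xs : List A) {f g} → (∀ x → f x ≤ g x) → ∑ xs f ≤ ∑ xs g
    ∑-mono-≤ [] f≤g = z≤n
    ∑-mono-≤ (x ∷ xs) f≤g = +-mono-≤ (f≤g x) (∑-mono-≤ xs f≤g)

    ∑-zero : ∀ (xs : List A) {f} → (∀ x → f x ≡ 0) → ∑ xs f ≡ 0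
    ∑-zero [] f≡0 = refl
    ∑-zero (x ∷ xs) f≡0 = cong₂ _+_ (f≡0 x) (∑-zero xs f≡0)

    ∑-distrib-+ : ∀ (xs : List A) f g → ∑[ x ∈ xs ] (f x + g x) ≡ ∑ xs f + ∑ xs g
    ∑-distrib-+ [] f g = refl
    ∑-distrib-+ (x ∷ xs) f g = trans (cong (f x + g x +_) (∑-distrib-+ xs f g))
      (solve 4 (λ a b c d → (a :+ b) :+ (c :+ d) := (a :+ c) :+ (b :+ d)) refl (f x) (g x) (∑ xs f) (∑ xs g))

    ∑-const-1 : ∀ (xs : List A) → ∑[ x ∈ xs ] 1 ≡ length xs
    ∑-const-1 [] = refl
    ∑-const-1 (x ∷ xs) = cong suc (∑-const-1 xs)

    ∈⇒≤∑ : ∀ {xs : List A} {x} f → x ∈ xs → f x ≤ ∑ xs f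
    ∈⇒≤∑ f (here refl) = m≤m+n _ _
    ∈⇒≤∑ {y ∷ _} f (there x∈xs) = ≤-trans (∈⇒≤∑ f x∈xs) (m≤n+m _ (f y))

  ∑-comm : {A B : Set} (xs : List A) (ys : List B) (f : A → B → ℕ) →
    ∑[ x ∈ xs ] ∑[ y ∈ ys ] f x y ≡ ∑[ y ∈ ys ] ∑[ x ∈ xs ] f x y
  ∑-comm [] ys f = sym (∑-zero ys (λ _ → refl))
  ∑-comm (x ∷ xs) ys f = trans (cong (∑ ys (f x) +_) (∑-comm xs ys f))
    (sym (∑-distrib-+ ys (f x) (λ y → ∑[ x' ∈ xs ] f x' y)))

  ∑-upTo-suc : ∀ N f → ∑ (upTo (suc N)) f ≡ ∑ (upTo N) f + f N
  ∑-upTo-suc N f = begin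
    ∑ (upTo (suc N)) f ≡⟨ cong (λ l → ∑ l f) (upTo-∷ʳ N) ⟨
    ∑ (upTo N ++ [ N ]) f ≡⟨ ∑-++ (upTo N) [ N ] f ⟩
    ∑ (upTo N) f + (f N + 0) ≡⟨ cong (∑ (upTo N) f +_) (+-identityʳ (f N)) ⟩
    ∑ (upTo N) f + f N ∎
    where open ≡-Reasoning

  length-filter-cartesianProduct : {A B : Set} {P : Pred (A × B) _} (P? : Decidable P) (xs : List A) (ys : List B) →
    length (filter P? (cartesianProduct xs ys)) ≡ ∑[ x ∈ xs ] ∑[ y ∈ ys ] 𝟙 (P? (x , y))
  length-filter-cartesianProduct P? [] ys = refl
  length-filter-cartesianProduct P? (x ∷ xs) ys = begin
    length (filter P? (map (x ,_) ys ++ cartesianProduct xs ys))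
      ≡⟨ cong length (filter-++ P? (map (x ,_) ys) (cartesianProduct xs ys)) ⟩
    length (filter P? (map (x ,_) ys) ++ filter P? (cartesianProduct xs ys))
      ≡⟨ length-++ (filter P? (map (x ,_) ys)) ⟩
    length (filter P? (map (x ,_) ys)) + length (filter P? (cartesianProduct xs ys))
      ≡⟨ cong₂ _+_ (length-filter-row ys) (length-filter-cartesianProduct P? xs ys) ⟩
    ∑[ y ∈ ys ] 𝟙 (P? (x , y)) + ∑[ x' ∈ xs ] ∑[ y ∈ ys ] 𝟙 (P? (x' , y)) ∎
    where
    open ≡-Reasoning
    length-filter-row : ∀ ys → length (filter P? (map (x ,_) ys)) ≡ ∑[ y ∈ ys ] 𝟙 (P? (x , y))
    length-filter-row [] = refl
    length-filter-row (y ∷ ys) with P? (x , y)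
    ... | yes _ = cong suc (length-filter-row ys)
    ... | no _ = length-filter-row ys


module NatEmbedding where
  open import Defs using (⟦_⟧)
  open FiniteSums
  open import Level using (0ℓ)
  open import Data.Nat as ℕ using (ℕ; z≤n)
  open import Data.Integer as ℤ using (+_)
  import Data.Integer.Properties as ℤ
  open import Data.Rational
  open import Data.Rational.Properties
  open import Data.Nat.Coprimality using (1-coprimeTo) renaming (sym to coprime-sym)
  open import Data.List using (List; []; _∷_)
  open import Data.Product using (_×_; _,_)
  open import Function using (_∘_)
  open import Relation.Nullary using (Dec; yes; no)
  open import Relation.Unary using (Pred; Decidable)
  open import Relation.Binary.PropositionalEquality

  ⟦_⟧′ : ℕ → ℚ
  ⟦ n ⟧′ = mkℚ (+ n) 0 (coprime-sym (1-coprimeTo n))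

  ⟦⟧≡⟦⟧′ : ∀ n → ⟦ n ⟧ ≡ ⟦ n ⟧′
  ⟦⟧≡⟦⟧′ n = normalize-coprime (coprime-sym (1-coprimeTo n))

  ⟦+⟧ : ∀ m n → ⟦ m ℕ.+ n ⟧ ≡ ⟦ m ⟧ + ⟦ n ⟧
  ⟦+⟧ m n = begin
    ⟦ m ℕ.+ n ⟧ ≡⟨ cong (_/ 1) (cong₂ ℤ._+_ (ℤ.*-identityʳ (+ m)) (ℤ.*-identityʳ (+ n))) ⟨
    ⟦ m ⟧′ + ⟦ n ⟧′ ≡⟨ cong₂ _+_ (⟦⟧≡⟦⟧′ m) (⟦⟧≡⟦⟧′ n) ⟨
    ⟦ m ⟧ + ⟦ n ⟧ ∎
    where open ≡-Reasoning

  ⟦*⟧ : ∀ m n → ⟦ m ℕ.* n ⟧ ≡ ⟦ m ⟧ * ⟦ n ⟧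
  ⟦*⟧ m n = begin
    ⟦ m ℕ.* n ⟧ ≡⟨ cong (_/ 1) (ℤ.pos-* m n) ⟩
    ⟦ m ⟧′ * ⟦ n ⟧′ ≡⟨ cong₂ _*_ (⟦⟧≡⟦⟧′ m) (⟦⟧≡⟦⟧′ n) ⟨
    ⟦ m ⟧ * ⟦ n ⟧ ∎
    where open ≡-Reasoning

  ⟦⟧-mono-≤ : ∀ {m n} → m ℕ.≤ n → ⟦ m ⟧ ≤ ⟦ n ⟧
  ⟦⟧-mono-≤ {m} {n} m≤n = subst₂ _≤_ (sym (⟦⟧≡⟦⟧′ m)) (sym (⟦⟧≡⟦⟧′ n))
    (*≤* (ℤ.*-monoʳ-≤-nonNeg (+ 1) (ℤ.+≤+ m≤n)))

  ⟦⟧-nonNeg : ∀ n → NonNegative ⟦ n ⟧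
  ⟦⟧-nonNeg n = nonNegative (⟦⟧-mono-≤ {0} {n} z≤n)

  ∑-scale-≤ : {A : Set} (xs : List A) (f g : A → ℕ) (c K : ℚ) →
    (∀ x → ⟦ f x ⟧ * c ≤ ⟦ g x ⟧ * K) → ⟦ ∑ xs f ⟧ * c ≤ ⟦ ∑ xs g ⟧ * K
  ∑-scale-≤ [] f g c K fc≤gK = ≤-reflexive (trans (*-zeroˡ c) (sym (*-zeroˡ K)))
  ∑-scale-≤ (x ∷ xs) f g c K fc≤gK = begin
    ⟦ f x ℕ.+ ∑ xs f ⟧ * c ≡⟨ cong (_* c) (⟦+⟧ (f x) _) ⟩
    (⟦ f x ⟧ + ⟦ ∑ xs f ⟧) * c ≡⟨ *-distribʳ-+ c ⟦ f x ⟧ _ ⟩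
    ⟦ f x ⟧ * c + ⟦ ∑ xs f ⟧ * c ≤⟨ +-mono-≤ (fc≤gK x) (∑-scale-≤ xs f g c K fc≤gK) ⟩
    ⟦ g x ⟧ * K + ⟦ ∑ xs g ⟧ * K ≡⟨ *-distribʳ-+ K ⟦ g x ⟧ _ ⟨
    (⟦ g x ⟧ + ⟦ ∑ xs g ⟧) * K ≡⟨ cong (_* K) (⟦+⟧ (g x) _) ⟨
    ⟦ g x ℕ.+ ∑ xs g ⟧ * K ∎
    where open ≤-Reasoning

  ∑∑-rows-≤ : {A B : Set} {R : Pred (A × B) 0ℓ} {D : Pred A 0ℓ} (R? : Decidable R) (D? : Decidable D)
    (xs : List A) (ys : List B) (c K : ℚ) → (∀ {a b} → R (a , b) → D a) →
    (∀ a → D a → ⟦ ∑[ b ∈ ys ] 𝟙 (R? (a , b)) ⟧ * c ≤ K) →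
    ⟦ ∑[ a ∈ xs ] ∑[ b ∈ ys ] 𝟙 (R? (a , b)) ⟧ * c ≤ ⟦ ∑[ a ∈ xs ] 𝟙 (D? a) ⟧ * K
  ∑∑-rows-≤ R? D? xs ys c K R⇒D row-≤ = ∑-scale-≤ xs _ _ c K (λ a → row a (D? a))
    where
    row : ∀ a (D?a : Dec _) → ⟦ ∑[ b ∈ ys ] 𝟙 (R? (a , b)) ⟧ * c ≤ ⟦ 𝟙 D?a ⟧ * K
    row a (yes Da) = ≤-trans (row-≤ a Da) (≤-reflexive (sym (*-identityˡ K)))
    row a (no ¬Da) = ≤-reflexive (begin
      ⟦ ∑[ b ∈ ys ] 𝟙 (R? (a , b)) ⟧ * c
        ≡⟨ cong (λ n → ⟦ n ⟧ * c) (∑-zero ys (λ b → 𝟙-no (¬Da ∘ R⇒D) (R? (a , b)))) ⟩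
      0ℚ * c ≡⟨ *-zeroˡ c ⟩
      0ℚ ≡⟨ *-zeroˡ K ⟨
      0ℚ * K ∎)
      where open ≡-Reasoning


module SeparatedSets where
  open import Defs using (⟦_⟧; InDyadic; inDyadic?)
  open FiniteSums
  open NatEmbedding
  open import Level using (0ℓ)
  open import Data.Nat as ℕ using (ℕ; zero; suc; z≤n; _%_)
  import Data.Nat.Properties as ℕ
  open import Data.Nat.DivMod using (m%n<n)
  open import Data.Integer using (+_)
  open import Data.Rational
  open import Data.Rational.Properties
  open import Data.List using (upTo)
  open import Data.List.Properties using (length-upTo)
  open import Data.List.Membership.Propositional.Properties using (∈-upTo⁺)
  open import Data.Product using (_×_; _,_; ∃-syntax; proj₁; proj₂)
  open import Data.Sum using (_⊎_; inj₁; inj₂)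
  open import Data.Empty using (⊥-elim)
  open import Relation.Nullary using (yes; no)
  open import Relation.Nullary.Decidable using (_×-dec_)
  open import Relation.Unary using (Pred; Decidable)
  open import Relation.Binary.PropositionalEquality

  countBelow : {P : Pred ℕ 0ℓ} → Decidable P → ℕ → ℕ
  countBelow P? N = ∑[ c ∈ upTo N ] 𝟙 (P? c)

  +-cancelˡ-< : ∀ r {p q} → r + p < r + q → p < q
  +-cancelˡ-< r {p} {q} r+p<r+q with q ≤? p
  ... | yes q≤p = ⊥-elim (<-irrefl refl (<-≤-trans r+p<r+q (+-monoʳ-≤ r q≤p)))
  ... | no q≰p = ≰⇒> q≰p

  module _ {P : Pred ℕ 0ℓ} (P? : Decidable P) (m : ℕ)
           (separated : ∀ {c c'} → P c → P c' → c ℕ.< c' → c ℕ.+ m ℕ.≤ c') where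

    record Spread (N k : ℕ) : Set where
      field
        lo hi : ℕ
        P-lo : P lo
        P-hi : P hi
        hi<N : hi ℕ.< N
        lo+k*m≤hi : lo ℕ.+ k ℕ.* m ℕ.≤ hi

    spread : ∀ N → countBelow P? N ≡ 0 ⊎ ∃[ k ] countBelow P? N ≡ suc k × Spread N k
    spread zero = inj₁ refl
    spread (suc N) rewrite ∑-upTo-suc N (λ c → 𝟙 (P? c)) | ℕ.+-comm (countBelow P? N) (𝟙 (P? N))
      with P? N | spread N
    ... | no _ | inj₁ none = inj₁ none
    ... | no _ | inj₂ (k , count≡ , s) = inj₂ (k , count≡ ,
      record { lo = lo ; hi = hi ; P-lo = P-lo ; P-hi = P-hi ; hi<N = ℕ.m<n⇒m<1+n hi<N ; lo+k*m≤hi = lo+k*m≤hi })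
      where open Spread s
    ... | yes PN | inj₁ none = inj₂ (0 , cong suc none ,
      record { lo = N ; hi = N ; P-lo = PN ; P-hi = PN ; hi<N = ℕ.n<1+n N ; lo+k*m≤hi = ℕ.≤-reflexive (ℕ.+-identityʳ N) })
    ... | yes PN | inj₂ (k , count≡ , s) = inj₂ (suc k , cong suc count≡ ,
      record { lo = lo ; hi = N ; P-lo = P-lo ; P-hi = PN ; hi<N = ℕ.n<1+n N ; lo+k*m≤hi = step })
      where
      open Spread s
      open ℕ.≤-Reasoning
      step : lo ℕ.+ suc k ℕ.* m ℕ.≤ N
      step = begin
        lo ℕ.+ (m ℕ.+ k ℕ.* m) ≡⟨ cong (lo ℕ.+_) (ℕ.+-comm m (k ℕ.* m)) ⟩
        lo ℕ.+ (k ℕ.* m ℕ.+ m) ≡⟨ ℕ.+-assoc lo (k ℕ.* m) m ⟨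
        lo ℕ.+ k ℕ.* m ℕ.+ m ≤⟨ ℕ.+-monoˡ-≤ m lo+k*m≤hi ⟩
        hi ℕ.+ m ≤⟨ separated P-hi PN hi<N ⟩
        N ∎

    separated-count-≤ : (L W : ℚ) → 0ℚ ≤ W → (∀ {c} → P c → L ≤ ⟦ c ⟧ × ⟦ c ⟧ < L + W) →
      ∀ N → ⟦ countBelow P? N ⟧ * ⟦ m ⟧ ≤ W + ⟦ m ⟧
    separated-count-≤ L W 0≤W inside N with spread N
    ... | inj₁ none rewrite none = begin
      0ℚ * ⟦ m ⟧ ≡⟨ *-zeroˡ ⟦ m ⟧ ⟩
      0ℚ ≤⟨ +-mono-≤ 0≤W (⟦⟧-mono-≤ {0} {m} z≤n) ⟩
      W + ⟦ m ⟧ ∎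
      where open ≤-Reasoning
    ... | inj₂ (k , count≡ , s) rewrite count≡ = begin
      ⟦ suc k ⟧ * ⟦ m ⟧ ≡⟨ ⟦*⟧ (suc k) m ⟨
      ⟦ m ℕ.+ k ℕ.* m ⟧ ≡⟨ ⟦+⟧ m (k ℕ.* m) ⟩
      ⟦ m ⟧ + ⟦ k ℕ.* m ⟧ ≤⟨ +-monoʳ-≤ ⟦ m ⟧ (<⇒≤ km<W) ⟩
      ⟦ m ⟧ + W ≡⟨ +-comm ⟦ m ⟧ W ⟩
      W + ⟦ m ⟧ ∎
      where
      open Spread s
      open ≤-Reasoning
      km<W : ⟦ k ℕ.* m ⟧ < W
      km<W = +-cancelˡ-< L (begin-strict
        L + ⟦ k ℕ.* m ⟧ ≤⟨ +-monoˡ-≤ ⟦ k ℕ.* m ⟧ (proj₁ (inside P-lo)) ⟩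
        ⟦ lo ⟧ + ⟦ k ℕ.* m ⟧ ≡⟨ ⟦+⟧ lo _ ⟨
        ⟦ lo ℕ.+ k ℕ.* m ⟧ ≤⟨ ⟦⟧-mono-≤ lo+k*m≤hi ⟩
        ⟦ hi ⟧ <⟨ proj₂ (inside P-hi) ⟩
        L + W ∎)

  residue-separated-count-≤ : (d : ℕ) .{{_ : ℕ.NonZero d}} {P : Pred ℕ 0ℓ} (P? : Decidable P) (m : ℕ) (L W : ℚ) →
    0ℚ ≤ W → (∀ {c} → P c → L ≤ ⟦ c ⟧ × ⟦ c ⟧ < L + W) →
    (∀ {c c'} → P c → P c' → c % d ≡ c' % d → c ℕ.< c' → c ℕ.+ m ℕ.≤ c') →
    ∀ N → ⟦ countBelow P? N ⟧ * ⟦ m ⟧ ≤ ⟦ d ⟧ * (W + ⟦ m ⟧)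
  residue-separated-count-≤ d {P} P? m L W 0≤W inside separated N = begin
    ⟦ countBelow P? N ⟧ * ⟦ m ⟧
      ≤⟨ *-monoʳ-≤-nonNeg ⟦ m ⟧ {{⟦⟧-nonNeg m}} (⟦⟧-mono-≤ split) ⟩
    ⟦ ∑[ r ∈ upTo d ] countBelow (inClass? r) N ⟧ * ⟦ m ⟧
      ≤⟨ ∑-scale-≤ (upTo d) _ (λ _ → 1) ⟦ m ⟧ (W + ⟦ m ⟧) per-class ⟩
    ⟦ ∑[ r ∈ upTo d ] 1 ⟧ * (W + ⟦ m ⟧)
      ≡⟨ cong (λ n → ⟦ n ⟧ * (W + ⟦ m ⟧)) (trans (∑-const-1 (upTo d)) (length-upTo d)) ⟩
    ⟦ d ⟧ * (W + ⟦ m ⟧) ∎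
    where
    open ≤-Reasoning
    InClass : ℕ → ℕ → Set
    InClass r c = P c × c % d ≡ r
    inClass? : ∀ r → Decidable (InClass r)
    inClass? r c = P? c ×-dec (c % d ℕ.≟ r)
    split : countBelow P? N ℕ.≤ ∑[ r ∈ upTo d ] countBelow (inClass? r) N
    split = ℕ.≤-trans (∑-mono-≤ (upTo N) in-own-class) (ℕ.≤-reflexive (∑-comm (upTo N) (upTo d) _))
      where
      in-own-class : ∀ c → 𝟙 (P? c) ℕ.≤ ∑[ r ∈ upTo d ] 𝟙 (inClass? r c)
      in-own-class c = ℕ.≤-trans (𝟙-mono (_, refl) (P? c) (inClass? (c % d) c))
        (∈⇒≤∑ (λ r → 𝟙 (inClass? r c)) (∈-upTo⁺ (m%n<n c d)))
    per-class : ∀ r → ⟦ countBelow (inClass? r) N ⟧ * ⟦ m ⟧ ≤ ⟦ 1 ⟧ * (W + ⟦ m ⟧)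
    per-class r = ≤-trans
      (separated-count-≤ (inClass? r) m (λ (Pc , c≡r) (Pc' , c'≡r) → separated Pc Pc' (trans c≡r (sym c'≡r)))
        L W 0≤W (λ (Pc , _) → inside Pc) N)
      (≤-reflexive (sym (*-identityˡ _)))

  inDyadic⇒interval : ∀ {X c} → InDyadic X c → X ≤ ⟦ c ⟧ × ⟦ c ⟧ < X + X
  inDyadic⇒interval {X} (X≤c , c<2X) = X≤c , <-≤-trans c<2X (≤-reflexive 2X≡X+X)
    where
    2X≡X+X : (+ 2 / 1) * X ≡ X + X
    2X≡X+X = trans (*-distribʳ-+ X 1ℚ 1ℚ) (cong₂ _+_ (*-identityˡ X) (*-identityˡ X))

  dyadic-count-≤ : ∀ X → 1ℚ ≤ X → ∀ N → ⟦ countBelow (inDyadic? X) N ⟧ ≤ X + X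
  dyadic-count-≤ X 1≤X N = begin
    ⟦ countBelow (inDyadic? X) N ⟧ ≡⟨ *-identityʳ _ ⟨
    ⟦ countBelow (inDyadic? X) N ⟧ * 1ℚ
      ≤⟨ separated-count-≤ (inDyadic? X) 1 (λ {c} _ _ c<c' → ℕ.≤-trans (ℕ.≤-reflexive (ℕ.+-comm c 1)) c<c')
           X X (≤-trans (⟦⟧-mono-≤ {0} {1} z≤n) 1≤X) (λ {c} → inDyadic⇒interval {X} {c}) N ⟩
    X + 1ℚ ≤⟨ +-monoʳ-≤ X 1≤X ⟩
    X + X ∎
    where open ≤-Reasoning


module Lifting where
  open import Defs using (_≡_[mod_])
  open import Data.Nat
  open import Data.Nat.Properties
  open import Data.Nat.DivMod
  open import Data.Nat.Divisibility
  open import Data.Nat.Primality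
  open import Data.Nat.Solver using (module +-*-Solver)
  open import Data.Sum using (inj₁; inj₂)
  open import Data.Empty using (⊥-elim)
  open import Relation.Nullary using (¬_)
  open import Relation.Binary.PropositionalEquality
  open +-*-Solver

  geometric : ℕ → ℕ → ℕ → ℕ
  geometric x y zero = 0
  geometric x y (suc n) = x ^ n + y * geometric x y n

  -- x ^ n − y ^ n = (x − y) * geometric x y n, with both sides moved so that no subtraction occurs.
  ^+*geometric : ∀ x y n → x ^ n + y * geometric x y n ≡ y ^ n + x * geometric x y n
  ^+*geometric x y zero rewrite *-zeroʳ y | *-zeroʳ x = refl
  ^+*geometric x y (suc n) = begin
    x * x ^ n + y * (x ^ n + y * g) ≡⟨ cong (λ z → x * x ^ n + y * z) (^+*geometric x y n) ⟩
    x * x ^ n + y * (y ^ n + x * g)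
      ≡⟨ solve 5 (λ x y X Y g → x :* X :+ y :* (Y :+ x :* g) := y :* Y :+ x :* (X :+ y :* g)) refl x y (x ^ n) (y ^ n) g ⟩
    y * y ^ n + x * (x ^ n + y * g) ∎
    where
    open ≡-Reasoning
    g : ℕ
    g = geometric x y n

  ∣^-^∣≡∣-∣*geometric : ∀ x y n → ∣ x ^ n - y ^ n ∣ ≡ ∣ x - y ∣ * geometric x y n
  ∣^-^∣≡∣-∣*geometric x y n = begin
    ∣ x ^ n - y ^ n ∣ ≡⟨ ∣m+n-m+o∣≡∣n-o∣ (x * g) (x ^ n) (y ^ n) ⟨
    ∣ x * g + x ^ n - x * g + y ^ n ∣ ≡⟨ cong₂ ∣_-_∣ (+-comm (x * g) (x ^ n)) (+-comm (x * g) (y ^ n)) ⟩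
    ∣ x ^ n + x * g - y ^ n + x * g ∣ ≡⟨ cong (λ z → ∣ x ^ n + x * g - z ∣) (^+*geometric x y n) ⟨
    ∣ x ^ n + x * g - x ^ n + y * g ∣ ≡⟨ ∣m+n-m+o∣≡∣n-o∣ (x ^ n) (x * g) (y * g) ⟩
    ∣ x * g - y * g ∣ ≡⟨ *-distribʳ-∣-∣ g x y ⟨
    ∣ x - y ∣ * g ∎
    where
    open ≡-Reasoning
    g : ℕ
    g = geometric x y n

  module _ (d : ℕ) .{{_ : NonZero d}} where

    %-cong-+ : ∀ {a a' b b'} → a % d ≡ a' % d → b % d ≡ b' % d → (a + b) % d ≡ (a' + b') % d
    %-cong-+ {a} {a'} {b} {b'} a≡a' b≡b' = begin
      (a + b) % d ≡⟨ %-distribˡ-+ a b d ⟩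
      (a % d + b % d) % d ≡⟨ cong₂ (λ u v → (u + v) % d) a≡a' b≡b' ⟩
      (a' % d + b' % d) % d ≡⟨ %-distribˡ-+ a' b' d ⟨
      (a' + b') % d ∎
      where open ≡-Reasoning

    %-cong-* : ∀ {a a' b b'} → a % d ≡ a' % d → b % d ≡ b' % d → (a * b) % d ≡ (a' * b') % d
    %-cong-* {a} {a'} {b} {b'} a≡a' b≡b' = begin
      (a * b) % d ≡⟨ %-distribˡ-* a b d ⟩
      (a % d * (b % d)) % d ≡⟨ cong₂ (λ u v → (u * v) % d) a≡a' b≡b' ⟩
      (a' % d * (b' % d)) % d ≡⟨ %-distribˡ-* a' b' d ⟨
      (a' * b') % d ∎
      where open ≡-Reasoning

    %≡%⇒[mod] : ∀ a b → a % d ≡ b % d → a ≡ b [mod d ]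
    %≡%⇒[mod] a b a≡b = divides ∣ a / d - b / d ∣ (begin
      ∣ a - b ∣ ≡⟨ cong₂ ∣_-_∣ (m≡m%n+[m/n]*n a d) (m≡m%n+[m/n]*n b d) ⟩
      ∣ a % d + a / d * d - b % d + b / d * d ∣ ≡⟨ cong (λ z → ∣ a % d + a / d * d - z + b / d * d ∣) a≡b ⟨
      ∣ a % d + a / d * d - a % d + b / d * d ∣ ≡⟨ ∣m+n-m+o∣≡∣n-o∣ (a % d) _ _ ⟩
      ∣ a / d * d - b / d * d ∣ ≡⟨ *-distribʳ-∣-∣ d (a / d) (b / d) ⟨
      ∣ a / d - b / d ∣ * d ∎)
      where open ≡-Reasoning

    [mod]⇒%≡% : ∀ a b → a ≡ b [mod d ] → a % d ≡ b % d
    [mod]⇒%≡% a b d∣a-b with ≤-total b a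
    ... | inj₁ b≤a = trans (cong (_% d) (sym (m+[n∸m]≡n b≤a)))
            (%-remove-+ʳ b (subst (d ∣_) (m≤n⇒∣n-m∣≡n∸m b≤a) d∣a-b))
    ... | inj₂ a≤b = sym (trans (cong (_% d) (sym (m+[n∸m]≡n a≤b)))
            (%-remove-+ʳ a (subst (d ∣_) (m≤n⇒∣m-n∣≡n∸m a≤b) d∣a-b)))

    [mod]-trans : ∀ a b c → a ≡ b [mod d ] → b ≡ c [mod d ] → a ≡ c [mod d ]
    [mod]-trans a b c a≡b b≡c = %≡%⇒[mod] a c (trans ([mod]⇒%≡% a b a≡b) ([mod]⇒%≡% b c b≡c))

    geometric-% : ∀ {x y} → x % d ≡ y % d → ∀ m → geometric x y (suc m) % d ≡ (suc m * x ^ m) % d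
    geometric-% {x} {y} x≡y zero rewrite *-zeroʳ y = refl
    geometric-% {x} {y} x≡y (suc m) = begin
      (x * x ^ m + y * geometric x y (suc m)) % d
        ≡⟨ %-cong-+ {x * x ^ m} refl (%-cong-* {y} (sym x≡y) (geometric-% x≡y m)) ⟩
      (x * x ^ m + x * (suc m * x ^ m)) % d
        ≡⟨ cong (_% d) (solve 3 (λ x X m → x :* X :+ x :* ((con 1 :+ m) :* X) := (con 2 :+ m) :* (x :* X)) refl x (x ^ m) m) ⟩
      (suc (suc m) * x ^ suc m) % d ∎
      where open ≡-Reasoning

  [mod]-sym : ∀ {d} a b → a ≡ b [mod d ] → b ≡ a [mod d ]
  [mod]-sym {d} a b = subst (d ∣_) (∣-∣-comm a b)

  [mod]∧<⇒+≤ : ∀ {d a b} → a ≡ b [mod d ] → a < b → a + d ≤ b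
  [mod]∧<⇒+≤ {d} {a} {b} d∣∣a-b∣ a<b = begin
    a + d ≤⟨ +-monoʳ-≤ a (∣⇒≤ {{>-nonZero (m<n⇒0<n∸m a<b)}} d∣b∸a) ⟩
    a + (b ∸ a) ≡⟨ m+[n∸m]≡n (<⇒≤ a<b) ⟩
    b ∎
    where
    open ≤-Reasoning
    d∣b∸a : d ∣ b ∸ a
    d∣b∸a = subst (d ∣_) (m≤n⇒∣m-n∣≡n∸m (<⇒≤ a<b)) d∣∣a-b∣

  p∤p∸1 : ∀ {p} → Prime p → ¬ p ∣ p ∸ 1
  p∤p∸1 {suc (suc k)} _ p∣p∸1 = <-irrefl refl (∣⇒≤ p∣p∸1)

  module _ {p : ℕ} (p-prime : Prime p) where
    private instance
      p≢0 : NonZero p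
      p≢0 = prime⇒nonZero p-prime

    ∣^⇒∣ : ∀ {x} n → p ∣ x ^ n → p ∣ x
    ∣^⇒∣ zero p∣1 = ⊥-elim (¬prime[1] (subst Prime (∣1⇒≡1 p∣1) p-prime))
    ∣^⇒∣ {x} (suc n) p∣x*xⁿ with euclidsLemma x (x ^ n) p-prime p∣x*xⁿ
    ... | inj₁ p∣x = p∣x
    ... | inj₂ p∣xⁿ = ∣^⇒∣ n p∣xⁿ

    ∤geometric : ∀ {x y m} → ¬ p ∣ suc m → ¬ p ∣ x → x % p ≡ y % p → ¬ p ∣ geometric x y (suc m)
    ∤geometric {x} {y} {m} p∤m+1 p∤x x≡y p∣g
      with euclidsLemma (suc m) (x ^ m) p-prime (m%n≡0⇒n∣m _ p (trans (sym (geometric-% p x≡y m)) (n∣m⇒m%n≡0 _ p p∣g)))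
    ... | inj₁ p∣m+1 = p∤m+1 p∣m+1
    ... | inj₂ p∣xᵐ = p∤x (∣^⇒∣ m p∣xᵐ)

    ^∣*∤⇒^∣ : ∀ α {a t} → ¬ p ∣ t → p ^ α ∣ a * t → p ^ α ∣ a
    ^∣*∤⇒^∣ zero {a} p∤t _ = 1∣ a
    ^∣*∤⇒^∣ (suc α) {a} {t} p∤t p^α+1∣at with euclidsLemma a t p-prime (m*n∣⇒m∣ p (p ^ α) p^α+1∣at)
    ... | inj₂ p∣t = ⊥-elim (p∤t p∣t)
    ... | inj₁ (divides a' refl) = subst (p * p ^ α ∣_) (*-comm p a') (*-monoʳ-∣ p (^∣*∤⇒^∣ α p∤t p^α∣a't))
      where
      p^α∣a't : p ^ α ∣ a' * t
      p^α∣a't = *-cancelˡ-∣ p (subst (p * p ^ α ∣_)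
        (solve 3 (λ a' p t → a' :* p :* t := p :* (a' :* t)) refl a' p t) p^α+1∣at)

    lift-congruence : ∀ α {n x y} → ¬ p ∣ n → ¬ p ∣ x → x % p ≡ y % p →
      (x ^ n) ≡ (y ^ n) [mod (p ^ α) ] → x ≡ y [mod (p ^ α) ]
    lift-congruence α {zero} p∤0 = ⊥-elim (p∤0 (_∣0 p))
    lift-congruence α {suc m} {x} {y} p∤n p∤x x≡y xⁿ≡yⁿ =
      ^∣*∤⇒^∣ α (∤geometric p∤n p∤x x≡y) (subst (p ^ α ∣_) (∣^-^∣≡∣-∣*geometric x y (suc m)) xⁿ≡yⁿ)


module PairCount where
  open import Defs
  open FiniteSums
  open NatEmbedding
  open SeparatedSets
  open Lifting
  open import Level using (0ℓ)
  open import Data.Nat as ℕ using (ℕ; _^_; _%_; _∸_)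
  import Data.Nat.Properties as ℕ
  open import Data.Nat.Divisibility using (_∣_; _∣?_; ∣m⇒∣m*n; ∣n⇒∣m*n)
  open import Data.Nat.Primality using (Prime; prime⇒nonZero)
  open import Data.Rational
  open import Data.Rational.Properties
  open import Data.Rational.Solver using (module +-*-Solver)
  open import Data.List using (upTo)
  open import Data.Product using (_×_; _,_; proj₁; proj₂; swap)
  open import Function using (_∘_)
  open import Data.Sum using (_⊎_; inj₁; inj₂)
  open import Relation.Nullary using (¬_)
  open import Relation.Nullary.Decidable using (_×-dec_; ¬?)
  open import Relation.Unary using (Pred; Decidable)
  open import Relation.Binary.PropositionalEquality

  module _ {p : ℕ} (p-prime : Prime p) (α : ℕ) where

    q : ℕ
    q = p ^ α

    n : ℕ
    n = p ∸ 1

    private instance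
      p≢0 : ℕ.NonZero p
      p≢0 = prime⇒nonZero p-prime
      q≢0 : ℕ.NonZero q
      q≢0 = ℕ.m^n≢0 p α

    Partner : ℚ → ℕ → ℕ → Set
    Partner X a c = InDyadic X c × ¬ p ∣ c × (a ^ n) ≡ (c ^ n) [mod q ]

    partner? : ∀ X a → Decidable (Partner X a)
    partner? X a c = inDyadic? X c ×-dec ¬? (p ∣? c) ×-dec (q ∣? ℕ.∣ a ^ n - c ^ n ∣)

    partners-separated : ∀ {X a c c'} → Partner X a c → Partner X a c' →
      c % p ≡ c' % p → c ℕ.< c' → c ℕ.+ q ℕ.≤ c'
    partners-separated {a = a} {c} {c'} (_ , p∤c , aⁿ≡cⁿ) (_ , _ , aⁿ≡c'ⁿ) c≡c' =
      [mod]∧<⇒+≤ (lift-congruence p-prime α (p∤p∸1 p-prime) p∤c c≡c'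
        ([mod]-trans q (c ^ n) (a ^ n) (c' ^ n) ([mod]-sym (a ^ n) (c ^ n) aⁿ≡cⁿ) aⁿ≡c'ⁿ))

    partner-count-≤ : ∀ X → 0ℚ ≤ X → ∀ a N →
      ⟦ countBelow (partner? X a) N ⟧ * ⟦ q ⟧ ≤ ⟦ p ⟧ * (X + ⟦ q ⟧)
    partner-count-≤ X 0≤X a = residue-separated-count-≤ p (partner? X a) q X X 0≤X
      (λ {c} (inDyadic , _) → inDyadic⇒interval {X} {c} inDyadic) partners-separated

    pair-count-≤ : {R : Pred (ℕ × ℕ) 0ℓ} (R? : Decidable R) (X Y : ℚ) → 1ℚ ≤ X → 1ℚ ≤ Y →
      (∀ {a b} → R (a , b) → InDyadic X a × Partner Y a b) → ∀ M N →
      ⟦ ∑[ a ∈ upTo M ] ∑[ b ∈ upTo N ] 𝟙 (R? (a , b)) ⟧ * ⟦ q ⟧ ≤ (X + X) * (⟦ p ⟧ * (Y + ⟦ q ⟧))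
    pair-count-≤ R? X Y 1≤X 1≤Y R⇒ M N = begin
      ⟦ ∑[ a ∈ upTo M ] ∑[ b ∈ upTo N ] 𝟙 (R? (a , b)) ⟧ * ⟦ q ⟧
        ≤⟨ ∑∑-rows-≤ R? (inDyadic? X) (upTo M) (upTo N) ⟦ q ⟧ K (proj₁ ∘ R⇒) row-≤ ⟩
      ⟦ countBelow (inDyadic? X) M ⟧ * K
        ≤⟨ *-monoʳ-≤-nonNeg K {{K-nonNeg}} (dyadic-count-≤ X 1≤X M) ⟩
      (X + X) * K ∎
      where
      open ≤-Reasoning
      0≤Y : 0ℚ ≤ Y
      0≤Y = ≤-trans (⟦⟧-mono-≤ {0} {1} ℕ.z≤n) 1≤Y
      K : ℚ
      K = ⟦ p ⟧ * (Y + ⟦ q ⟧)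
      K-nonNeg : NonNegative K
      K-nonNeg = nonNeg*nonNeg⇒nonNeg ⟦ p ⟧ {{⟦⟧-nonNeg p}} (Y + ⟦ q ⟧)
                 {{nonNeg+nonNeg⇒nonNeg Y {{nonNegative 0≤Y}} ⟦ q ⟧ {{⟦⟧-nonNeg q}}}}
      row-≤ : ∀ a → InDyadic X a → ⟦ ∑[ b ∈ upTo N ] 𝟙 (R? (a , b)) ⟧ * ⟦ q ⟧ ≤ K
      row-≤ a _ = ≤-trans (*-monoʳ-≤-nonNeg ⟦ q ⟧ {{⟦⟧-nonNeg q}} (⟦⟧-mono-≤ row⊆partners)) (partner-count-≤ Y 0≤Y a N)
        where
        row⊆partners : ∑[ b ∈ upTo N ] 𝟙 (R? (a , b)) ℕ.≤ countBelow (partner? Y a) N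
        row⊆partners = ∑-mono-≤ (upTo N) λ b → 𝟙-mono (proj₂ ∘ R⇒) (R? (a , b)) (partner? Y a b)

    counted⇒row : ∀ {A B a b} → Counted p α A B (a , b) → InDyadic A a × Partner B a b
    counted⇒row {a = a} (inA , inB , p∤ab , _ , aⁿ≡bⁿ) = inA , inB , p∤ab ∘ ∣n⇒∣m*n a , aⁿ≡bⁿ

    counted⇒column : ∀ {A B a b} → Counted p α A B (a , b) → InDyadic B b × Partner A b a
    counted⇒column {a = a} {b} (inA , inB , p∤ab , _ , aⁿ≡bⁿ) =
      inB , inA , p∤ab ∘ ∣m⇒∣m*n b , [mod]-sym (a ^ n) (b ^ n) aⁿ≡bⁿ

    bound-shape : ∀ X Y → X ≤ Y → (X + X) * (⟦ p ⟧ * (Y + ⟦ q ⟧)) ≡ ⟦ p ℕ.+ p ⟧ * (X * Y + ⟦ q ⟧ * (X ⊓ Y))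
    bound-shape X Y X≤Y = begin
      (X + X) * (⟦ p ⟧ * (Y + ⟦ q ⟧))
        ≡⟨ solve 4 (λ X Y P Q → (X :+ X) :* (P :* (Y :+ Q)) := (P :+ P) :* (X :* Y :+ Q :* X)) refl X Y ⟦ p ⟧ ⟦ q ⟧ ⟩
      (⟦ p ⟧ + ⟦ p ⟧) * (X * Y + ⟦ q ⟧ * X)
        ≡⟨ cong₂ (λ P m → P * (X * Y + ⟦ q ⟧ * m)) (⟦+⟧ p p) (p≤q⇒p⊓q≡p X≤Y) ⟨
      ⟦ p ℕ.+ p ⟧ * (X * Y + ⟦ q ⟧ * (X ⊓ Y)) ∎
      where
      open ≡-Reasoning
      open +-*-Solver using (solve; _:+_; _:*_; _:=_)

    D0count≡∑∑ : ∀ A B → D0count p α A B ≡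
      ∑[ a ∈ upTo (dyadicBound A) ] ∑[ b ∈ upTo (dyadicBound B) ] 𝟙 (counted? p α A B (a , b))
    D0count≡∑∑ A B = length-filter-cartesianProduct (counted? p α A B) (upTo (dyadicBound A)) (upTo (dyadicBound B))

    rows-≤ : ∀ A B → 1ℚ ≤ A → 1ℚ ≤ B →
      ⟦ D0count p α A B ⟧ * ⟦ q ⟧ ≤ (A + A) * (⟦ p ⟧ * (B + ⟦ q ⟧))
    rows-≤ A B 1≤A 1≤B = subst (λ m → ⟦ m ⟧ * ⟦ q ⟧ ≤ (A + A) * (⟦ p ⟧ * (B + ⟦ q ⟧)))
      (sym (D0count≡∑∑ A B))
      (pair-count-≤ (counted? p α A B) A B 1≤A 1≤B counted⇒row (dyadicBound A) (dyadicBound B))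

    columns-≤ : ∀ A B → 1ℚ ≤ A → 1ℚ ≤ B →
      ⟦ D0count p α A B ⟧ * ⟦ q ⟧ ≤ (B + B) * (⟦ p ⟧ * (A + ⟦ q ⟧))
    columns-≤ A B 1≤A 1≤B = subst (λ m → ⟦ m ⟧ * ⟦ q ⟧ ≤ (B + B) * (⟦ p ⟧ * (A + ⟦ q ⟧)))
      (sym (trans (D0count≡∑∑ A B) (∑-comm (upTo (dyadicBound A)) (upTo (dyadicBound B)) _)))
      (pair-count-≤ (counted? p α A B ∘ swap) B A 1≤B 1≤A counted⇒column (dyadicBound B) (dyadicBound A))

    D0count-≤ : ∀ A B → 1ℚ ≤ A → 1ℚ ≤ B →
      ⟦ D0count p α A B ⟧ * ⟦ q ⟧ ≤ ⟦ p ℕ.+ p ⟧ * (A * B + ⟦ q ⟧ * (A ⊓ B))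
    D0count-≤ A B 1≤A 1≤B = by-cases (≤-total A B)
      where
      by-cases : A ≤ B ⊎ B ≤ A → ⟦ D0count p α A B ⟧ * ⟦ q ⟧ ≤ ⟦ p ℕ.+ p ⟧ * (A * B + ⟦ q ⟧ * (A ⊓ B))
      by-cases (inj₁ A≤B) = ≤-trans (rows-≤ A B 1≤A 1≤B) (≤-reflexive (bound-shape A B A≤B))
      by-cases (inj₂ B≤A) = ≤-trans (columns-≤ A B 1≤A 1≤B) (≤-reflexive (begin
        (B + B) * (⟦ p ⟧ * (A + ⟦ q ⟧)) ≡⟨ bound-shape B A B≤A ⟩
        ⟦ p ℕ.+ p ⟧ * (B * A + ⟦ q ⟧ * (B ⊓ A)) ≡⟨ cong₂ (λ u v → ⟦ p ℕ.+ p ⟧ * (u + ⟦ q ⟧ * v)) (*-comm B A) (⊓-comm B A) ⟩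
        ⟦ p ℕ.+ p ⟧ * (A * B + ⟦ q ⟧ * (A ⊓ B)) ∎))
        where open ≡-Reasoning

open import Defs
open import Data.Nat using (ℕ; _^_)
import Data.Nat as ℕ
open import Data.Nat.Primality using (Prime)
open import Data.Rational using (ℚ; 1ℚ; _≤_; _*_; _+_; _⊓_)
open import Data.Product using (∃-syntax; _,_)
open import Relation.Binary.PropositionalEquality using (_≢_)

lemma2p13 : (p : ℕ) → Prime p → p ≢ 2 →
    ∃[ C ] ((α : ℕ) (A B : ℚ) → 1ℚ ≤ A → 1ℚ ≤ B →
    ⟦ D0count p α A B ⟧ * ⟦ p ^ α ⟧ ≤ ⟦ C ⟧ * (A * B + ⟦ p ^ α ⟧ * (A ⊓ B)))
lemma2p13 p p-prime _ = p ℕ.+ p , PairCount.D0count-≤ p-prime
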